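{- Let $F:\mathbb{F}_{2^n}\to\mathbb{F}_{2^n}$ be a function and let $L_1,L_2$ be bijective $\mathbb{F}_2$-linear maps $\mathbb{F}_{2^n}\to\mathbb{F}_{2^n}$ with $L_1=(L_1^{ -1})^*$ and $L_2=(L_2^{ -1})^*$. Set $F'=L_2\circ F\circ L_1$. If $\{(x,F(x)):x\in\mathbb{F}_{2^n}\}$ is formally self dual under the trace pairing, then so is $\{(x,F'(x)):x\in\mathbb{F}_{2^n}\}$.
   Context: $\mathrm{Tr}:\mathbb{F}_{2^n}\to\mathbb{F}_2$ is the absolute trace. For an $\mathbb{F}_2$-linear $L$ on $\mathbb{F}_{2^n}$, $L^*$ is its adjoint with respect to $(u,v)\mapsto\mathrm{Tr}(uv)$, i.e. $\mathrm{Tr}(L(u)v)=\mathrm{Tr}(uL^*(v))$. On the additive group $G=\mathbb{F}_{2^n}^2$, the trace pairing is $\langle (x,y),(a,b)\rangle=(-1)^{\mathrm{Tr}(ax+by)}$; a set $S\subset G$ is formally self dual under it if for all $(a,b)\in G$: $\big|\sum_{(x,y)\in S}(-1)^{\mathrm{Tr}(ax+by)}\big|^2=|S|\cdot|\{(s,t)\in S^2:s-t=(a,b)\}|$ (i.e. $S$ and $\Delta(S)$ form a formally dual pair for the isomorphism $\Delta:G\to\hat G$ determined by the pairing). -}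

module Defs where

open import Data.Nat as ℕ using (ℕ; zero; suc)
open import Data.Integer as ℤ using (ℤ; +_; -[1+_])
open import Data.List using (List; []; _∷_; length; foldr; map; filter; cartesianProduct)
open import Data.List.Membership.Propositional using (_∈_)
open import Data.List.Relation.Unary.Unique.Propositional using (Unique)
open import Data.Product using (Σ; _×_; _,_; proj₁; proj₂)
open import Data.Bool using (Bool; true; false; T; _∧_)
open import Relation.Nullary using (¬_; Dec; yes; no)
open import Relation.Nullary.Decidable using (⌊_⌋)
open import Relation.Binary.PropositionalEquality using (_≡_)
open import Algebra.Structures using (IsCommutativeRing)

-- A model of the finite field 𝔽_{2^n}: a field (with propositional equality
-- and decidable equality) whose elements are enumerated by a duplicate-free
-- complete list of length 2^n.  (Any two such fields are isomorphic.)
record GF2^ (n : ℕ) : Set₁ where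
  infixl 6 _+_
  infixl 7 _*_
  field
    Carrier : Set
    _+_ _*_ : Carrier → Carrier → Carrier
    -_      : Carrier → Carrier
    0# 1#   : Carrier
    isCommutativeRing : IsCommutativeRing _≡_ _+_ _*_ -_ 0# 1#
    0≢1     : ¬ (0# ≡ 1#)
    inverse : ∀ x → ¬ (x ≡ 0#) → Σ Carrier (λ y → x * y ≡ 1#)
    _≟_     : (x y : Carrier) → Dec (x ≡ y)
    elements : List Carrier
    complete : ∀ x → x ∈ elements
    unique   : Unique elements
    size     : length elements ≡ 2 ℕ.^ n

module _ {n : ℕ} (K : GF2^ n) where
  open GF2^ K

  pow : Carrier → ℕ → Carrier
  pow x zero    = 1#
  pow x (suc k) = x * pow x k

  Tr : Carrier → Carrier
  Tr x = go n
    where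
    go : ℕ → Carrier
    go zero    = 0#
    go (suc i) = pow x (2 ℕ.^ i) + go i

  χ : Carrier → ℤ
  χ x with ⌊ Tr x ≟ 0# ⌋
  ... | true  = + 1
  ... | false = -[1+ 0 ]

  -- 𝔽₂-linear maps (over 𝔽₂, linearity is additivity; scalars are 0,1)
  IsF2Linear : (Carrier → Carrier) → Set
  IsF2Linear L = (∀ u v → L (u + v) ≡ L u + L v) × (L 0# ≡ 0#)

  IsAdjointOf : (M L : Carrier → Carrier) → Set
  IsAdjointOf M L = ∀ u v → Tr (L u * v) ≡ Tr (u * M v)

  G : Set
  G = Carrier × Carrier

  Gelements : List G
  Gelements = cartesianProduct elements elements

  sumℤ : List ℤ → ℤ
  sumℤ = foldr ℤ._+_ (+ 0)

  Subset : Set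
  Subset = G → Bool

  members : Subset → List G
  members S = filter (λ g → Data.Bool.Properties.T? (S g)) Gelements
    where import Data.Bool.Properties

  charSum : Subset → G → ℤ
  charSum S (a , b) = sumℤ (map (λ g → χ (a * proj₁ g + b * proj₂ g)) (members S))

  diffCount : Subset → G → ℕ
  diffCount S (a , b) =
    length (filter (λ p → Relation.Nullary.Decidable._×-dec_
                             ((proj₁ (proj₁ p) - proj₁ (proj₂ p)) ≟ a)
                             ((proj₂ (proj₁ p) - proj₂ (proj₂ p)) ≟ b))
                   (cartesianProduct (members S) (members S)))
    where
    _-_ : Carrier → Carrier → Carrier
    x - y = x + (- y)

  FormallySelfDual : Subset → Set
  FormallySelfDual S =
    ∀ (c : G) → charSum S c ℤ.* charSum S c
                ≡ + (length (members S) ℕ.* diffCount S c)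

  graph : (Carrier → Carrier) → Subset
  graph F (x , y) = ⌊ y ≟ F x ⌋

{-# OPTIONS --safe #-}
module Submission where

-- Put φ = L₁ × L₂⁻¹ on G = 𝔽_{2^n}².  Then graph(L₂ ∘ F ∘ L₁) = φ⁻¹(graph F), φ is
-- additive, and the hypotheses Lᵢ = (Lᵢ⁻¹)* say exactly that L₁ and L₂⁻¹ preserve
-- the trace form Tr(uv), hence that φ preserves Tr(ax + by) (Tr is additive since a
-- field with 2^n elements has characteristic 2).  Reindexing through φ gives
-- charSum φ⁻¹(S) c = charSum S (φ c) and diffCount φ⁻¹(S) c = diffCount S (φ c), so
-- the defining identity of formal self-duality transfers from S to φ⁻¹(S).

open import Defs
open import Function.Base using (_∘_)
open import Function.Bundles using (_↔_; _⇔_; Inverse; Injection; mk⇔; mk↔ₛ′)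
open import Data.Nat using (ℕ)

open import Algebra.Bundles using (CommutativeMonoid; CommutativeRing)
open import Algebra.Structures using (IsCommutativeRing)
open import Data.Bool using (T)
open import Data.Bool.Properties using (T?)
open import Data.Empty using (⊥; ⊥-elim)
open import Data.Fin using (toℕ)
open import Data.Fin.Properties using (toℕ-injective)
import Data.Integer as ℤ
import Data.Integer.Properties as ℤ
open import Data.List using (List; []; _∷_; length; foldr; map; filter; cartesianProduct; lookup)
open import Data.List.Properties using (map-∘; map-cong; length-map)
open import Data.List.Membership.Propositional using (_∈_)
open import Data.List.Membership.Propositional.Properties
  using (∈-filter⁺; ∈-filter⁻; ∈-map⁺; ∈-map⁻; ∈-cartesianProduct⁺; ∈-cartesianProduct⁻)
open import Data.List.Membership.Propositional.Properties.WithK using (unique∧set⇒bag)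
open import Data.List.Relation.Binary.BagAndSetEquality using (∼bag⇒↭)
open import Data.List.Relation.Binary.Permutation.Propositional using (_↭_; ↭⇒↭ₛ)
open import Data.List.Relation.Binary.Permutation.Propositional.Properties
  using (↭-length; map⁺)
open import Data.List.Relation.Binary.Permutation.Setoid.Properties using (foldr-commMonoid)
import Data.List.Relation.Unary.All as All
open import Data.List.Relation.Unary.Any using (here; index)
open import Data.List.Relation.Unary.Any.Properties using (lookup-index)
open import Data.List.Relation.Unary.Unique.Propositional using (Unique; []; _∷_)
import Data.List.Relation.Unary.Unique.Propositional.Properties as Unique
open import Data.Nat using (suc; zero; _^_; _<_; _<?_)
import Data.Nat as ℕ
import Data.Nat.Properties as ℕ
open import Data.Product using (∃; _×_; _,_; proj₁; proj₂) renaming (map to map-×)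
open import Data.Product.Function.NonDependent.Propositional using (_×-↔_)
open import Data.Unit using (⊤; tt)
open import Function.Properties.Inverse using (↔-sym; Inverse⇒Injection)
open import Relation.Nullary using (¬_; Dec; yes; no)
open import Relation.Nullary.Decidable using (_×-dec_; does-⇔; isYes≗does)
open import Relation.Unary using (Decidable)
open import Relation.Unary.Properties using (∁?)
open import Relation.Binary.PropositionalEquality
  using (_≡_; refl; sym; trans; cong; cong₂; subst; module ≡-Reasoning)

-- Tr is defined through a where-bound loop that is out of scope.  Abstracting the
-- size `suc m` in Tr-suc leaves the constraint `loop {w} K x m = traceLoop {w} K x m`,
-- which determines traceLoop as that very loop.
mutual
  traceLoop : ∀ {n} (K : GF2^ n) → GF2^.Carrier K → ℕ → GF2^.Carrier K
  traceLoop = _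

  private
    Tr-suc : ∀ {m} (K : GF2^ (suc m)) x → Tr K x ≡ GF2^._+_ K (pow K x (2 ^ m)) _
    Tr-suc K x = refl

    traceLoop-solution : ∀ {m} (K : GF2^ (suc m)) x → ⊤
    traceLoop-solution {m} K x with suc m | K | x | Tr-suc K x
    ... | _ | K′ | x′ | eq = constrain eq
      where
      constrain : _ ≡ GF2^._+_ K′ (pow K′ x′ (2 ^ m)) (traceLoop K′ x′ m) → ⊤
      constrain _ = tt

sumℤ-↭ : ∀ {xs ys} → xs ↭ ys → foldr ℤ._+_ (ℤ.+ 0) xs ≡ foldr ℤ._+_ (ℤ.+ 0) ys
sumℤ-↭ p = foldr-commMonoid ℤ-+-0.setoid ℤ-+-0.isCommutativeMonoid (↭⇒↭ₛ p)
  where module ℤ-+-0 = CommutativeMonoid ℤ.+-0-commutativeMonoid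

unique-↭ : ∀ {A : Set} {xs ys : List A} → Unique xs → Unique ys →
           (∀ {x} → x ∈ xs → x ∈ ys) → (∀ {x} → x ∈ ys → x ∈ xs) → xs ↭ ys
unique-↭ xs! ys! xs⊆ys ys⊆xs = ∼bag⇒↭ (unique∧set⇒bag xs! ys! (mk⇔ xs⊆ys ys⊆xs))

module _ {A B : Set} (ψ : A ↔ B) where
  open Inverse ψ

  ↭-map-inverse : ∀ {xs ys} → Unique xs → Unique ys →
                  (∀ {x} → x ∈ xs → to x ∈ ys) → (∀ {y} → y ∈ ys → from y ∈ xs) →
                  ys ↭ map to xs
  ↭-map-inverse {xs} {ys} xs! ys! to-∈ from-∈ =
    unique-↭ ys! (Unique.map⁺ (Injection.injective (Inverse⇒Injection ψ)) xs!) into outof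
    where
    into : ∀ {y} → y ∈ ys → y ∈ map to xs
    into {y} y∈ys = subst (_∈ map to xs) (strictlyInverseˡ y) (∈-map⁺ to (from-∈ y∈ys))
    outof : ∀ {y} → y ∈ map to xs → y ∈ ys
    outof y∈ with _ , x∈xs , refl ← ∈-map⁻ to y∈ = to-∈ x∈xs

length-filter-∁ : ∀ {A : Set} {P : A → Set} (P? : Decidable P) xs →
                  length xs ≡ length (filter P? xs) ℕ.+ length (filter (∁? P?) xs)
length-filter-∁ P? []       = refl
length-filter-∁ P? (x ∷ xs) with P? x
... | yes _ = cong suc (length-filter-∁ P? xs)
... | no  _ = trans (cong suc (length-filter-∁ P? xs)) (sym (ℕ.+-suc _ _))

∈-length-one : ∀ {A : Set} {xs : List A} {a b : A} → length xs ≡ 1 → a ∈ xs → b ∈ xs → a ≡ b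
∈-length-one {xs = _ ∷ []} _ (here refl) (here refl) = refl

-- Splitting a complete enumeration by comparing the positions of x and σ x, the
-- elements that come before their image correspond (via σ) to those that come
-- after it, and the remaining ones are the fixed points.
module _ {A : Set} {xs : List A} (xs! : Unique xs) (complete : ∀ x → x ∈ xs)
         (σ : A → A) (σ-involutive : ∀ x → σ (σ x) ≡ x) where

  private
    position : A → ℕ
    position x = toℕ (index (complete x))

    position-injective : ∀ {x y} → position x ≡ position y → x ≡ y
    position-injective {x} {y} eq = begin
      x                               ≡⟨ lookup-index (complete x) ⟩
      lookup xs (index (complete x))  ≡⟨ cong (lookup xs) (toℕ-injective eq) ⟩
      lookup xs (index (complete y))  ≡⟨ lookup-index (complete y) ⟨
      y                               ∎
      where open ≡-Reasoning

    rises? : Decidable (λ x → position x < position (σ x))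
    rises? x = position x <? position (σ x)
    falls? : Decidable (λ x → position (σ x) < position x)
    falls? x = position (σ x) <? position x

    rises nonRises falls fixed : List A
    rises    = filter rises? xs
    nonRises = filter (∁? rises?) xs
    falls    = filter falls? nonRises
    fixed    = filter (∁? falls?) nonRises

    rises! : Unique rises
    rises! = Unique.filter⁺ rises? xs!

    nonRises! : Unique nonRises
    nonRises! = Unique.filter⁺ (∁? rises?) xs!

    position-σσ : ∀ x → position (σ (σ x)) ≡ position x
    position-σσ x = cong position (σ-involutive x)

    rises⇒< : ∀ {x} → x ∈ rises → position x < position (σ x)
    rises⇒< = proj₂ ∘ ∈-filter⁻ rises? {xs = xs}

    falls⇒> : ∀ {x} → x ∈ falls → position (σ x) < position x
    falls⇒> = proj₂ ∘ ∈-filter⁻ falls? {xs = nonRises}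

    fixed⇒≡ : ∀ {x} → x ∈ fixed → position x ≡ position (σ x)
    fixed⇒≡ x∈ with x∈nonRises , ≯ ← ∈-filter⁻ (∁? falls?) {xs = nonRises} x∈ =
      ℕ.≤-antisym (ℕ.≮⇒≥ ≯) (ℕ.≮⇒≥ (proj₂ (∈-filter⁻ (∁? rises?) {xs = xs} x∈nonRises)))

    falls↭σ[rises] : falls ↭ map σ rises
    falls↭σ[rises] = ↭-map-inverse (mk↔ₛ′ σ σ σ-involutive σ-involutive)
      rises! (Unique.filter⁺ falls? nonRises!) rise⇒fall fall⇒rise
      where
      rise⇒fall : ∀ {x} → x ∈ rises → σ x ∈ falls
      rise⇒fall {x} x∈ =
        ∈-filter⁺ falls? (∈-filter⁺ (∁? rises?) (complete (σ x)) σx≮σσx)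
                  (subst (_< position (σ x)) (sym (position-σσ x)) (rises⇒< x∈))
        where
        σx≮σσx : ¬ position (σ x) < position (σ (σ x))
        σx≮σσx = ℕ.<-asym (rises⇒< x∈) ∘ subst (position (σ x) <_) (position-σσ x)
      fall⇒rise : ∀ {x} → x ∈ falls → σ x ∈ rises
      fall⇒rise {x} x∈ = ∈-filter⁺ rises? (complete (σ x))
        (subst (position (σ x) <_) (sym (position-σσ x)) (falls⇒> x∈))

  module _ (a : A) (σa≡a : σ a ≡ a) (fixed⇒a : ∀ x → σ x ≡ x → x ≡ a) where

    private
      fixed↭[a] : fixed ↭ a ∷ []
      fixed↭[a] = unique-↭ (Unique.filter⁺ (∁? falls?) nonRises!) (All.[] ∷ []) fixed⇒≡a ≡a⇒fixed
        where
        fixed⇒≡a : ∀ {x} → x ∈ fixed → x ∈ a ∷ []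
        fixed⇒≡a {x} x∈ = here (fixed⇒a x (sym (position-injective (fixed⇒≡ x∈))))
        ≡a⇒fixed : ∀ {x} → x ∈ a ∷ [] → x ∈ fixed
        ≡a⇒fixed (here refl) =
          ∈-filter⁺ (∁? falls?) (∈-filter⁺ (∁? rises?) (complete a) (ℕ.<-irrefl (cong position (sym σa≡a))))
                    (ℕ.<-irrefl (cong position σa≡a))

    length-odd-if-unique-fixed-point : ∃ λ k → length xs ≡ suc (2 ℕ.* k)
    length-odd-if-unique-fixed-point = k , (begin
      length xs                                ≡⟨ length-filter-∁ rises? xs ⟩
      k ℕ.+ length nonRises                    ≡⟨ cong (k ℕ.+_) (length-filter-∁ falls? nonRises) ⟩
      k ℕ.+ (length falls ℕ.+ length fixed)    ≡⟨ cong₂ (λ l m → k ℕ.+ (l ℕ.+ m)) |falls|≡k (↭-length fixed↭[a]) ⟩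
      k ℕ.+ (k ℕ.+ 1)                          ≡⟨ cong (k ℕ.+_) (ℕ.+-comm k 1) ⟩
      k ℕ.+ suc k                              ≡⟨ ℕ.+-suc k k ⟩
      suc (k ℕ.+ k)                            ≡⟨ cong (λ l → suc (k ℕ.+ l)) (ℕ.+-identityʳ k) ⟨
      suc (2 ℕ.* k)                            ∎)
      where
      open ≡-Reasoning
      k : ℕ
      k = length rises
      |falls|≡k : length falls ≡ k
      |falls|≡k = trans (↭-length falls↭σ[rises]) (length-map σ rises)

module _ {n : ℕ} (K : GF2^ n) where
  open GF2^ K
  open IsCommutativeRing isCommutativeRing
    using (+-comm; +-identityˡ; +-identityʳ; -‿inverseʳ; *-comm; *-assoc; *-identityˡ; *-identityʳ;
           distribˡ; distribʳ; zeroˡ; zeroʳ)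
  open ≡-Reasoning

  private
    ring : CommutativeRing _ _
    ring = record { isCommutativeRing = isCommutativeRing }

  open import Algebra.Properties.Group (CommutativeRing.+-group ring)
    using (inverseʳ-unique; ε⁻¹≈ε; ⁻¹-involutive)
  open import Algebra.Properties.CommutativeSemigroup (CommutativeRing.+-commutativeSemigroup ring)
    using (interchange)

  x+x≡2x : ∀ x → x + x ≡ (1# + 1#) * x
  x+x≡2x x = begin
    x + x            ≡⟨ cong₂ _+_ (*-identityˡ x) (*-identityˡ x) ⟨
    1# * x + 1# * x  ≡⟨ distribʳ x 1# 1# ⟨
    (1# + 1#) * x    ∎

  -- If 2 were invertible, x ↦ -x would be an involution whose only fixed point is 0,
  -- so the field would have an odd number 2^n of elements, forcing 0# = 1#.
  characteristic-two : 1# + 1# ≡ 0#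
  characteristic-two with (1# + 1#) ≟ 0#
  ... | yes 2≡0 = 2≡0
  ... | no  2≢0 = ⊥-elim (not-a-power-of-two n size)
    where
    half : Carrier
    half = proj₁ (inverse _ 2≢0)

    -x≡x⇒x≡0 : ∀ x → - x ≡ x → x ≡ 0#
    -x≡x⇒x≡0 x -x≡x = begin
      x                       ≡⟨ *-identityˡ x ⟨
      1# * x                  ≡⟨ cong (_* x) (proj₂ (inverse _ 2≢0)) ⟨
      ((1# + 1#) * half) * x  ≡⟨ cong (_* x) (*-comm _ half) ⟩
      (half * (1# + 1#)) * x  ≡⟨ *-assoc half _ x ⟩
      half * ((1# + 1#) * x)  ≡⟨ cong (half *_) (x+x≡2x x) ⟨
      half * (x + x)          ≡⟨ cong (λ y → half * (x + y)) -x≡x ⟨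
      half * (x + - x)        ≡⟨ cong (half *_) (-‿inverseʳ x) ⟩
      half * 0#               ≡⟨ zeroʳ half ⟩
      0#                      ∎

    odd : ∃ λ k → length elements ≡ suc (2 ℕ.* k)
    odd = length-odd-if-unique-fixed-point unique complete -_ ⁻¹-involutive 0# ε⁻¹≈ε -x≡x⇒x≡0

    not-a-power-of-two : ∀ m → length elements ≡ 2 ^ m → ⊥
    not-a-power-of-two zero    eq = 0≢1 (∈-length-one eq (complete 0#) (complete 1#))
    not-a-power-of-two (suc m) eq = ℕ.even≢odd (2 ^ m) (proj₁ odd) (trans (sym eq) (proj₂ odd))

  x+x≡0 : ∀ x → x + x ≡ 0#
  x+x≡0 x = begin
    x + x          ≡⟨ x+x≡2x x ⟩
    (1# + 1#) * x  ≡⟨ cong (_* x) characteristic-two ⟩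
    0# * x         ≡⟨ zeroˡ x ⟩
    0#             ∎

  square-+ : ∀ x y → (x + y) * (x + y) ≡ x * x + y * y
  square-+ x y = begin
    (x + y) * (x + y)                  ≡⟨ distribˡ (x + y) x y ⟩
    (x + y) * x + (x + y) * y          ≡⟨ cong₂ _+_ (distribʳ x x y) (trans (distribʳ y x y) (+-comm _ _)) ⟩
    (x * x + y * x) + (y * y + x * y)  ≡⟨ interchange (x * x) (y * x) (y * y) (x * y) ⟩
    (x * x + y * y) + (y * x + x * y)  ≡⟨ cong (λ z → (x * x + y * y) + (z + x * y)) (*-comm y x) ⟩
    (x * x + y * y) + (x * y + x * y)  ≡⟨ cong (x * x + y * y +_) (x+x≡0 (x * y)) ⟩
    (x * x + y * y) + 0#               ≡⟨ +-identityʳ _ ⟩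
    x * x + y * y                      ∎

  pow-+ : ∀ x a b → pow K x (a ℕ.+ b) ≡ pow K x a * pow K x b
  pow-+ x zero    b = sym (*-identityˡ _)
  pow-+ x (suc a) b = trans (cong (x *_) (pow-+ x a b)) (sym (*-assoc _ _ _))

  pow-2^suc : ∀ x i → pow K x (2 ^ suc i) ≡ pow K x (2 ^ i) * pow K x (2 ^ i)
  pow-2^suc x i = trans (pow-+ x (2 ^ i) (2 ^ i ℕ.+ 0))
                        (cong (λ k → pow K x (2 ^ i) * pow K x k) (ℕ.+-identityʳ (2 ^ i)))

  frobenius : ∀ i x y → pow K (x + y) (2 ^ i) ≡ pow K x (2 ^ i) + pow K y (2 ^ i)
  frobenius zero    x y = begin
    (x + y) * 1#      ≡⟨ *-identityʳ _ ⟩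
    x + y             ≡⟨ cong₂ _+_ (*-identityʳ x) (*-identityʳ y) ⟨
    x * 1# + y * 1#   ∎
  frobenius (suc i) x y = begin
    pow K (x + y) (2 ^ suc i)          ≡⟨ pow-2^suc (x + y) i ⟩
    pow K (x + y) (2 ^ i) * pow K (x + y) (2 ^ i)
                                       ≡⟨ cong₂ _*_ (frobenius i x y) (frobenius i x y) ⟩
    (xᵢ + yᵢ) * (xᵢ + yᵢ)              ≡⟨ square-+ xᵢ yᵢ ⟩
    xᵢ * xᵢ + yᵢ * yᵢ                  ≡⟨ cong₂ _+_ (pow-2^suc x i) (pow-2^suc y i) ⟨
    pow K x (2 ^ suc i) + pow K y (2 ^ suc i)  ∎
    where
    xᵢ yᵢ : Carrier
    xᵢ = pow K x (2 ^ i)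
    yᵢ = pow K y (2 ^ i)

  traceLoop-+ : ∀ i x y → traceLoop K (x + y) i ≡ traceLoop K x i + traceLoop K y i
  traceLoop-+ zero    x y = sym (+-identityˡ 0#)
  traceLoop-+ (suc i) x y =
    trans (cong₂ _+_ (frobenius i x y) (traceLoop-+ i x y))
          (interchange (pow K x (2 ^ i)) (pow K y (2 ^ i)) (traceLoop K x i) (traceLoop K y i))

  Tr-+ : ∀ x y → Tr K (x + y) ≡ Tr K x + Tr K y
  Tr-+ = traceLoop-+ n

  χ-cong : ∀ {u v} → Tr K u ≡ Tr K v → χ K u ≡ χ K v
  χ-cong {u} {v} eq with Tr K u ≟ 0# | Tr K v ≟ 0#
  ... | yes _   | yes _   = refl
  ... | no  _   | no  _   = refl
  ... | yes u≡0 | no  v≢0 = ⊥-elim (v≢0 (trans (sym eq) u≡0))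
  ... | no  u≢0 | yes v≡0 = ⊥-elim (u≢0 (trans eq v≡0))

  module _ {f : Carrier → Carrier} (f-linear : IsF2Linear K f) where
    private
      f-+ : ∀ u v → f (u + v) ≡ f u + f v
      f-+ = proj₁ f-linear

    linear-neg : ∀ x → f (- x) ≡ - f x
    linear-neg x = inverseʳ-unique (f x) (f (- x)) (begin
      f x + f (- x)  ≡⟨ f-+ x (- x) ⟨
      f (x + - x)    ≡⟨ cong f (-‿inverseʳ x) ⟩
      f 0#           ≡⟨ proj₂ f-linear ⟩
      0#             ∎)

    linear-sub : ∀ x y → f (x + - y) ≡ f x + - f y
    linear-sub x y = trans (f-+ x (- y)) (cong (f x +_) (linear-neg y))

  inverse-linear : (L : Carrier ↔ Carrier) → IsF2Linear K (Inverse.to L) → IsF2Linear K (Inverse.from L)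
  inverse-linear L (to-+ , to-0) = from-+ , trans (cong from (sym to-0)) (strictlyInverseʳ 0#)
    where
    open Inverse L
    from-+ : ∀ u v → from (u + v) ≡ from u + from v
    from-+ u v = begin
      from (u + v)                      ≡⟨ cong from (cong₂ _+_ (strictlyInverseˡ u) (strictlyInverseˡ v)) ⟨
      from (to (from u) + to (from v))  ≡⟨ cong from (to-+ (from u) (from v)) ⟨
      from (to (from u + from v))       ≡⟨ strictlyInverseʳ _ ⟩
      from u + from v                   ∎

  PreservesTraceForm : (Carrier → Carrier) → Set
  PreservesTraceForm f = ∀ u v → Tr K (f u * f v) ≡ Tr K (u * v)

  module _ (L : Carrier ↔ Carrier) (L-adjoint : IsAdjointOf K (Inverse.to L) (Inverse.from L)) where
    open Inverse L

    adjoint-inverse⇒to-preservesTraceForm : PreservesTraceForm to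
    adjoint-inverse⇒to-preservesTraceForm u v = begin
      Tr K (to u * to v)       ≡⟨ L-adjoint (to u) v ⟨
      Tr K (from (to u) * v)   ≡⟨ cong (λ w → Tr K (w * v)) (strictlyInverseʳ u) ⟩
      Tr K (u * v)             ∎

    adjoint-inverse⇒from-preservesTraceForm : PreservesTraceForm from
    adjoint-inverse⇒from-preservesTraceForm u v = begin
      Tr K (from u * from v)   ≡⟨ L-adjoint u (from v) ⟩
      Tr K (u * to (from v))   ≡⟨ cong (λ w → Tr K (u * w)) (strictlyInverseˡ v) ⟩
      Tr K (u * v)             ∎

  infixl 6 _⊖_
  infix  7 _·_

  _⊖_ : G K → G K → G K
  (s₁ , s₂) ⊖ (t₁ , t₂) = s₁ + - t₁ , s₂ + - t₂

  _·_ : G K → G K → Carrier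
  (a , b) · (x , y) = a * x + b * y

  ×-preserves-⊖ : ∀ {f g} → IsF2Linear K f → IsF2Linear K g →
                  ∀ s t → map-× f g (s ⊖ t) ≡ map-× f g s ⊖ map-× f g t
  ×-preserves-⊖ f-linear g-linear (s₁ , s₂) (t₁ , t₂) =
    cong₂ _,_ (linear-sub f-linear s₁ t₁) (linear-sub g-linear s₂ t₂)

  ×-preserves-· : ∀ {f g} → PreservesTraceForm f → PreservesTraceForm g →
                  ∀ c h → Tr K (map-× f g c · map-× f g h) ≡ Tr K (c · h)
  ×-preserves-· {f} {g} f-preserves g-preserves (a , b) (x , y) = begin
    Tr K (f a * f x + g b * g y)         ≡⟨ Tr-+ _ _ ⟩
    Tr K (f a * f x) + Tr K (g b * g y)  ≡⟨ cong₂ _+_ (f-preserves a x) (g-preserves b y) ⟩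
    Tr K (a * x) + Tr K (b * y)          ≡⟨ Tr-+ _ _ ⟨
    Tr K (a * x + b * y)                 ∎

  ∈-members⁺ : ∀ {S g} → T (S g) → g ∈ members K S
  ∈-members⁺ {S} {x , y} = ∈-filter⁺ (λ g → T? (S g)) (∈-cartesianProduct⁺ (complete x) (complete y))

  ∈-members⁻ : ∀ {S g} → g ∈ members K S → T (S g)
  ∈-members⁻ {S} = proj₂ ∘ ∈-filter⁻ (λ g → T? (S g)) {xs = Gelements K}

  members-unique : ∀ S → Unique (members K S)
  members-unique S = Unique.filter⁺ (λ g → T? (S g)) (Unique.cartesianProduct⁺ unique unique)

  -- Phrased exactly as the filter in diffCount, so that diffCount K S c unfolds to
  -- length (differencePairs S c).
  differs? : (c : G K) (p : G K × G K) →
             Dec (proj₁ (proj₁ p ⊖ proj₂ p) ≡ proj₁ c × proj₂ (proj₁ p ⊖ proj₂ p) ≡ proj₂ c)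
  differs? c (s , t) = (proj₁ (s ⊖ t) ≟ proj₁ c) ×-dec (proj₂ (s ⊖ t) ≟ proj₂ c)

  differencePairs : Subset K → G K → List (G K × G K)
  differencePairs S c = filter (differs? c) (cartesianProduct (members K S) (members K S))

  differencePairs-unique : ∀ S c → Unique (differencePairs S c)
  differencePairs-unique S c =
    Unique.filter⁺ (differs? c) (Unique.cartesianProduct⁺ (members-unique S) (members-unique S))

  ∈-differencePairs⁺ : ∀ {S c s t} → s ∈ members K S → t ∈ members K S → s ⊖ t ≡ c →
                       (s , t) ∈ differencePairs S c
  ∈-differencePairs⁺ s∈S t∈S refl = ∈-filter⁺ (differs? _) (∈-cartesianProduct⁺ s∈S t∈S) (refl , refl)

  ∈-differencePairs⁻ : ∀ {S c s t} → (s , t) ∈ differencePairs S c →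
                       (s ∈ members K S × t ∈ members K S) × s ⊖ t ≡ c
  ∈-differencePairs⁻ {S} {c} p∈
    with p∈S² , eq₁ , eq₂ ← ∈-filter⁻ (differs? c) {xs = cartesianProduct (members K S) (members K S)} p∈
    = ∈-cartesianProduct⁻ (members K S) (members K S) p∈S² , cong₂ _,_ eq₁ eq₂

  module _ (φ : G K ↔ G K)
           (φ-⊖ : ∀ s t → Inverse.to φ (s ⊖ t) ≡ Inverse.to φ s ⊖ Inverse.to φ t)
           (φ-· : ∀ c g → Tr K (Inverse.to φ c · Inverse.to φ g) ≡ Tr K (c · g))
           {S S′ : Subset K} (S′≗S∘φ : ∀ g → S′ g ≡ S (Inverse.to φ g)) where
    open Inverse φ

    private
      S′⇒S : ∀ {g} → g ∈ members K S′ → to g ∈ members K S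
      S′⇒S {g} g∈S′ = ∈-members⁺ (subst T (S′≗S∘φ g) (∈-members⁻ g∈S′))

      S⇒S′ : ∀ {g} → g ∈ members K S → from g ∈ members K S′
      S⇒S′ {g} g∈S = ∈-members⁺ (subst T (sym (trans (S′≗S∘φ (from g)) (cong S (strictlyInverseˡ g))))
                                         (∈-members⁻ g∈S))

      to-injective : ∀ {g h} → to g ≡ to h → g ≡ h
      to-injective = Injection.injective (Inverse⇒Injection φ)

    members-pullback : members K S′ ↭ map from (members K S)
    members-pullback = ↭-map-inverse (↔-sym φ) (members-unique S) (members-unique S′) S⇒S′ S′⇒S

    differencePairs-pullback : ∀ c → differencePairs S′ c ↭ map (map-× from from) (differencePairs S (to c))
    differencePairs-pullback c = ↭-map-inverse (↔-sym φ ×-↔ ↔-sym φ)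
      (differencePairs-unique S (to c)) (differencePairs-unique S′ c) S⇒S′² S′⇒S²
      where
      S′⇒S² : ∀ {p} → p ∈ differencePairs S′ c → map-× to to p ∈ differencePairs S (to c)
      S′⇒S² {s , t} p∈ with (s∈S′ , t∈S′) , s⊖t≡c ← ∈-differencePairs⁻ p∈ =
        ∈-differencePairs⁺ (S′⇒S s∈S′) (S′⇒S t∈S′) (trans (sym (φ-⊖ s t)) (cong to s⊖t≡c))
      S⇒S′² : ∀ {p} → p ∈ differencePairs S (to c) → map-× from from p ∈ differencePairs S′ c
      S⇒S′² {s , t} p∈ with (s∈S , t∈S) , s⊖t≡φc ← ∈-differencePairs⁻ p∈ =
        ∈-differencePairs⁺ (S⇒S′ s∈S) (S⇒S′ t∈S) (to-injective (begin
          to (from s ⊖ from t)       ≡⟨ φ-⊖ (from s) (from t) ⟩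
          to (from s) ⊖ to (from t)  ≡⟨ cong₂ _⊖_ (strictlyInverseˡ s) (strictlyInverseˡ t) ⟩
          s ⊖ t                      ≡⟨ s⊖t≡φc ⟩
          to c                       ∎))

    size-pullback : length (members K S′) ≡ length (members K S)
    size-pullback = trans (↭-length members-pullback) (length-map from (members K S))

    charSum-pullback : ∀ c → charSum K S′ c ≡ charSum K S (to c)
    charSum-pullback c = begin
      sumℤ K (map (χ K ∘ (c ·_)) (members K S′))           ≡⟨ sumℤ-↭ (map⁺ (χ K ∘ (c ·_)) members-pullback) ⟩
      sumℤ K (map (χ K ∘ (c ·_)) (map from (members K S)))  ≡⟨ cong (sumℤ K) (map-∘ (members K S)) ⟨
      sumℤ K (map (χ K ∘ (c ·_) ∘ from) (members K S))      ≡⟨ cong (sumℤ K) (map-cong character-pullback (members K S)) ⟩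
      sumℤ K (map (χ K ∘ (to c ·_)) (members K S))          ∎
      where
      character-pullback : ∀ g → χ K (c · from g) ≡ χ K (to c · g)
      character-pullback g = χ-cong (begin
        Tr K (c · from g)            ≡⟨ φ-· c (from g) ⟨
        Tr K (to c · to (from g))    ≡⟨ cong (λ h → Tr K (to c · h)) (strictlyInverseˡ g) ⟩
        Tr K (to c · g)              ∎)

    diffCount-pullback : ∀ c → diffCount K S′ c ≡ diffCount K S (to c)
    diffCount-pullback c =
      trans (↭-length (differencePairs-pullback c)) (length-map _ (differencePairs S (to c)))

    formallySelfDual-pullback : FormallySelfDual K S → FormallySelfDual K S′
    formallySelfDual-pullback S-selfDual c = begin
      charSum K S′ c ℤ.* charSum K S′ c
        ≡⟨ cong₂ ℤ._*_ (charSum-pullback c) (charSum-pullback c) ⟩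
      charSum K S (to c) ℤ.* charSum K S (to c)
        ≡⟨ S-selfDual (to c) ⟩
      ℤ.+ (length (members K S) ℕ.* diffCount K S (to c))
        ≡⟨ cong₂ (λ k l → ℤ.+ (k ℕ.* l)) size-pullback (diffCount-pullback c) ⟨
      ℤ.+ (length (members K S′) ℕ.* diffCount K S′ c)  ∎

  graph-pullback : ∀ F (L₁ L₂ : Carrier ↔ Carrier) g →
                   graph K (Inverse.to L₂ ∘ F ∘ Inverse.to L₁) g
                   ≡ graph K F (map-× (Inverse.to L₁) (Inverse.from L₂) g)
  graph-pullback F L₁ L₂ (x , y) =
    trans (isYes≗does (y ≟ _))
          (trans (does-⇔ y≡L₂z⇔L₂⁻¹y≡z (y ≟ _) (from y ≟ _)) (sym (isYes≗does (from y ≟ _))))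
    where
    open Inverse L₂
    y≡L₂z⇔L₂⁻¹y≡z : y ≡ to (F (Inverse.to L₁ x)) ⇔ from y ≡ F (Inverse.to L₁ x)
    y≡L₂z⇔L₂⁻¹y≡z = mk⇔ inverseʳ (λ eq → sym (inverseˡ (sym eq)))

proposition6p18 : (n : ℕ) (K : GF2^ n) (F : GF2^.Carrier K → GF2^.Carrier K)
    (L₁ L₂ : GF2^.Carrier K ↔ GF2^.Carrier K)
    → IsF2Linear K (Inverse.to L₁) → IsF2Linear K (Inverse.to L₂)
    → IsAdjointOf K (Inverse.to L₁) (Inverse.from L₁)
    → IsAdjointOf K (Inverse.to L₂) (Inverse.from L₂)
    → FormallySelfDual K (graph K F)
    → FormallySelfDual K (graph K (Inverse.to L₂ ∘ F ∘ Inverse.to L₁))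
proposition6p18 n K F L₁ L₂ L₁-linear L₂-linear L₁-adjoint L₂-adjoint =
  formallySelfDual-pullback K (L₁ ×-↔ ↔-sym L₂)
    (×-preserves-⊖ K L₁-linear (inverse-linear K L₂ L₂-linear))
    (×-preserves-· K (adjoint-inverse⇒to-preservesTraceForm K L₁ L₁-adjoint)
                     (adjoint-inverse⇒from-preservesTraceForm K L₂ L₂-adjoint))
    (graph-pullback K F L₁ L₂)
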